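{- Let $A$ be a deterministic WORM-memory automaton on the memory model $W_{1.5}$ with $k$ heads and $\#Q$ states, and let $w$ be an input word of length $n$. If $A$ accepts $w$, then between two subsequent return moves (moves to the initial cell) the automaton visits no more than $n^k\#Q$ new cells.
   Context: The 1.5-way tape $W_{1.5}$ has cells $0,1,2,\dots$, initial cell $0$, and from each cell $n$ an edge $n\to n+1$ marked $+$ and an edge $n\to 0$ marked $-$ (a return move). A WORM-memory automaton on $W_{1.5}$ with $k$ heads has a finite state set $Q$, input alphabet $\Sigma$ with endmarkers $\triangleleft,\triangleright$, memory alphabet $\Delta\cup\{\mathsf{void}\}$, a transition function mapping (state, the $k$ input symbols under its 2-way read-only heads, current memory symbol) to (new state, a move in $\{ -1,0,+1\}$ for each head, and $+$, $-$ or "stay" for the memory position), an initial state, accepting states, writing states $Q_w$ and a filling function $\varphi\colon Q_w\to\Delta$. Initially all cells are void. In a writing state $q$: a void current cell gets $\varphi(q)$ written; a cell already containing $\varphi(q)$ is unchanged; a cell with a different symbol causes an error. Applying the transition function on a void cell is an error. Errors cause rejection. It accepts iff its deterministic run reaches an accepting state. -}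

module Defs where

open import Data.Nat using (ℕ; zero; suc; _+_; _*_; _^_; _≤_; _<_; _≤?_; _≡ᵇ_)
open import Data.Nat.Properties using ()
open import Data.Fin using (Fin)
open import Data.Fin.Properties using () renaming (_≟_ to _≟ᶠ_)
open import Data.Bool using (Bool; true; false; not; if_then_else_)
open import Data.Maybe using (Maybe; just; nothing; _>>=_)
open import Data.List using (List; []; _∷_; length; upTo)
open import Data.Bool.ListAction using (any)
open import Data.Vec using (Vec; []; _∷_)
open import Data.Product using (_×_; _,_; Σ-syntax)
open import Relation.Nullary using (yes; no)
open import Relation.Binary.PropositionalEquality using (_≡_)

-- Input tape (read-only, 2-way): ▷ w ◁ , positions 0 .. length w + 1

data TapeSym (σ : ℕ) : Set where
  lend : TapeSym σ
  rend : TapeSym σ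
  sym  : Fin σ → TapeSym σ

readRest : ∀ {σ} → List (Fin σ) → ℕ → TapeSym σ
readRest []      _       = rend
readRest (a ∷ w) zero    = sym a
readRest (a ∷ w) (suc i) = readRest w i

readTape : ∀ {σ} → List (Fin σ) → ℕ → TapeSym σ
readTape w zero    = lend
readTape w (suc i) = readRest w i

data HMove : Set where
  left stay right : HMove

-- moves on the memory W_{1.5}: + (n → n+1), − (return n → 0), stay
data MMove : Set where
  plus minus mstay : MMove

-- WORM-memory automaton on W_{1.5} with k heads.
-- States Q = Fin s (#Q = s), input alphabet Σ = Fin σ,
-- memory alphabet Δ = Fin d, void represented by 'nothing'.

record WORM (s σ d k : ℕ) : Set where
  field
    trans     : Fin s → Vec (TapeSym σ) k → Maybe (Fin d) →
                Fin s × Vec HMove k × MMove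
    initial   : Fin s
    accepting : Fin s → Bool
    -- writing states together with the filling function φ:
    -- fill q ≡ just x  iff  q ∈ Q_w and φ(q) = x
    fill      : Fin s → Maybe (Fin d)

record Config (s d k : ℕ) : Set where
  constructor config
  field
    state : Fin s
    heads : Vec ℕ k
    mpos  : ℕ
    mem   : ℕ → Maybe (Fin d)

-- moving a head on a tape with positions 0 .. n+1 (n = length w);
-- falling off the tape is an error
moveHead : ℕ → HMove → ℕ → Maybe ℕ
moveHead n left  zero    = nothing
moveHead n left  (suc i) = just i
moveHead n stay  i       = just i
moveHead n right i with i ≤? n
... | yes _ = just (suc i)
... | no  _ = nothing

moveHeads : ∀ {k} → ℕ → Vec HMove k → Vec ℕ k → Maybe (Vec ℕ k)
moveHeads n []       []       = just []
moveHeads n (m ∷ ms) (h ∷ hs) =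
  moveHead n m h >>= λ h' → moveHeads n ms hs >>= λ hs' → just (h' ∷ hs')

readHeads : ∀ {σ k} → List (Fin σ) → Vec ℕ k → Vec (TapeSym σ) k
readHeads w []       = []
readHeads w (h ∷ hs) = readTape w h ∷ readHeads w hs

moveMem : MMove → ℕ → ℕ
moveMem plus  p = suc p
moveMem minus p = 0
moveMem mstay p = p

writeCell : ∀ {d} → (ℕ → Maybe (Fin d)) → ℕ → Fin d → ℕ → Maybe (Fin d)
writeCell mem p x q = if p ≡ᵇ q then just x else mem q

module _ {s σ d k : ℕ} (A : WORM s σ d k) (w : List (Fin σ)) where
  open WORM A

  initConfig : Config s d k
  initConfig = config initial (Data.Vec.replicate k 0) 0 (λ _ → nothing)

  -- writing phase of a step (nothing = error)
  writePhase : Config s d k → Maybe (ℕ → Maybe (Fin d))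
  writePhase (config q hs p mem) with fill q
  ... | nothing = just mem
  ... | just x with mem p
  ...   | nothing = just (writeCell mem p x)
  ...   | just y with y ≟ᶠ x
  ...     | yes _ = just mem
  ...     | no  _ = nothing

  -- one step: writing phase, then the transition function
  -- (applying it on a void cell is an error); also returns the memory move
  transition : Config s d k → Maybe (Config s d k × MMove)
  transition c@(config q hs p _) with writePhase c
  ... | nothing = nothing
  ... | just mem' with mem' p
  ...   | nothing = nothing
  ...   | just x with trans q (readHeads w hs) (just x)
  ...     | q' , ms , mm =
    moveHeads (length w) ms hs >>= λ hs' →
    just (config q' hs' (moveMem mm p) mem' , mm)

  step : Config s d k → Maybe (Config s d k)
  step c = transition c >>= λ { (c' , _) → just c' }

  -- configuration at time t (nothing = an error occurred before)
  run : ℕ → Maybe (Config s d k)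
  run zero    = just initConfig
  run (suc t) = run t >>= step

  AcceptsAt : ℕ → Set
  AcceptsAt T =
    Σ[ c ∈ Config s d k ] (run T ≡ just c × accepting (Config.state c) ≡ true)
    × (∀ t → t < T → ∀ c → run t ≡ just c → accepting (Config.state c) ≡ false)

  ReturnAt : ℕ → Set
  ReturnAt t = Σ[ c ∈ Config s d k ] Σ[ c' ∈ Config s d k ]
    (run t ≡ just c × transition c ≡ just (c' , minus))

  -- memory cell visited at time t (meaningful only while the run is defined)
  cellAt : ℕ → ℕ
  cellAt t with run t
  ... | just c  = Config.mpos c
  ... | nothing = 0

  isNew : ℕ → Bool
  isNew t = not (any (λ t' → cellAt t' ≡ᵇ cellAt t) (upTo t))

  newCellsFrom : ℕ → ℕ → ℕ
  newCellsFrom a zero      = 0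
  newCellsFrom a (suc len) =
    (if isNew a then 1 else 0) + newCellsFrom (suc a) len

-- Between two return moves the memory head only stays or moves right, so the visited
-- cell is non-decreasing. When a time t visits a new cell, every cell from the head onwards
-- is still void: the head reaches a cell only through all smaller ones, so a written cell
-- beyond it would force an earlier visit to the current one. Hence if two such times
-- t < t' in the window had the same state and input head positions, the configuration at t'
-- would be the one at t with its memory translated by the distance between the memory heads,
-- and the run from t would replay the run from t'. The return move ending the window would
-- then happen already strictly inside it. So the new-cell times of a window inject into
-- (head positions, state), of which there are (n + 2)^k · #Q.

module Submission where

open import Defs hiding (sym)
open import Data.Bool using (Bool; true; false; T; if_then_else_)
open import Data.Bool.Properties using (T-≡; T-not-≡)
open import Data.Fin using (Fin; zero; suc; toℕ; combine)
open import Data.Fin.Properties using (toℕ-fromℕ<; combine-injective; injective⇒≤) renaming (_≟_ to _≟ᶠ_)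
open import Data.List using (List; length)
open import Data.List.Membership.Propositional using (lose)
open import Data.List.Membership.Propositional.Properties using (∈-upTo⁺)
open import Data.List.Relation.Unary.Any.Properties using (any⁺)
open import Data.Maybe using (Maybe; just; nothing; fromMaybe)
open import Data.Nat
  using (ℕ; zero; suc; _+_; _*_; _^_; _≤_; _<_; _∸_; _≤′_; ≤′-refl; ≤′-step; z≤n; s≤s; s≤s⁻¹;
         _≡ᵇ_; _≤?_; NonZero; _%_)
open import Data.Nat.DivMod using (_mod_; m<n⇒m%n≡m)
open import Data.Nat.Properties
open import Data.Product using (Σ-syntax; _×_; _,_; proj₁; map₁; map₂)
open import Data.Sum using (_⊎_; inj₁; inj₂)
open import Data.Vec using (Vec; []; _∷_; replicate)
open import Data.Vec.Relation.Unary.All using (All; []; _∷_)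
open import Function using (_∘_; Equivalence)
open import Relation.Binary.Definitions using (tri<; tri≈; tri>)
open import Relation.Binary.PropositionalEquality
open import Relation.Nullary using (¬_; yes; no; contradiction)

≡ᵇ-+-cancelˡ : ∀ sh p q → (sh + p ≡ᵇ sh + q) ≡ (p ≡ᵇ q)
≡ᵇ-+-cancelˡ zero     p q = refl
≡ᵇ-+-cancelˡ (suc sh) p q = ≡ᵇ-+-cancelˡ sh p q

writeCell-≢ : ∀ {d} (m : ℕ → Maybe (Fin d)) {p q} x → p ≢ q → writeCell m p x q ≡ m q
writeCell-≢ m {p} {q} x p≢q with p ≡ᵇ q in eq
... | false = refl
... | true  = contradiction (≡ᵇ⇒≡ p q (Equivalence.from T-≡ eq)) p≢q

writeCell-+ : ∀ {d} {m m' : ℕ → Maybe (Fin d)} sh {p} x {q} →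
  m' (sh + q) ≡ m q → writeCell m' (sh + p) x (sh + q) ≡ writeCell m p x q
writeCell-+ sh {p} x {q} eq rewrite ≡ᵇ-+-cancelˡ sh p q with p ≡ᵇ q
... | true  = refl
... | false = eq

≤-moveMem : ∀ mm p → mm ≢ minus → p ≤ moveMem mm p
≤-moveMem plus  p _     = n≤1+n p
≤-moveMem minus p ≢minus = contradiction refl ≢minus
≤-moveMem mstay p _     = ≤-refl

moveMem-+ : ∀ mm sh p → mm ≢ minus → moveMem mm (sh + p) ≡ sh + moveMem mm p
moveMem-+ plus  sh p _      = sym (+-suc sh p)
moveMem-+ minus sh p ≢minus = contradiction refl ≢minus
moveMem-+ mstay sh p _      = refl

moveMem-cases : ∀ mm p → moveMem mm p ≡ 0 ⊎ moveMem mm p ≡ p ⊎ moveMem mm p ≡ suc p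
moveMem-cases plus  p = inj₂ (inj₂ refl)
moveMem-cases minus p = inj₁ refl
moveMem-cases mstay p = inj₂ (inj₁ refl)

moveHead-< : ∀ n m {h h'} → h < 2 + n → moveHead n m h ≡ just h' → h' < 2 + n
moveHead-< n left  {suc h} h< refl = <-trans (n<1+n h) h<
moveHead-< n stay  h< refl = h<
moveHead-< n right {h} h< eq with h ≤? n
moveHead-< n right h< refl | yes h≤n = s≤s (s≤s h≤n)

moveHeads-< : ∀ {j} n (ms : Vec HMove j) {hs hs'} →
  All (_< 2 + n) hs → moveHeads n ms hs ≡ just hs' → All (_< 2 + n) hs'
moveHeads-< n []       {[]}     []         refl = []
moveHeads-< n (m ∷ ms) {h ∷ hs} (h< ∷ hs<) eq with moveHead n m h in eh
... | just h' with moveHeads n ms hs in ehs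
moveHeads-< n (m ∷ ms) {h ∷ hs} (h< ∷ hs<) refl | just h' | just hs' =
  moveHead-< n m h< eh ∷ moveHeads-< n ms hs< ehs

-- Reducing modulo B only makes encode total; on heads below B it is the identity.
encode : ∀ {j} B .{{_ : NonZero B}} → Vec ℕ j → Fin (B ^ j)
encode B []       = zero
encode B (h ∷ hs) = combine (h mod B) (encode B hs)

mod-injective-< : ∀ {B} .{{_ : NonZero B}} {h h'} → h < B → h' < B → h mod B ≡ h' mod B → h ≡ h'
mod-injective-< {B} {h} {h'} h<B h'<B eq = begin
  h              ≡⟨ sym (m<n⇒m%n≡m h<B) ⟩
  h % B          ≡⟨ sym (toℕ-fromℕ< _) ⟩
  toℕ (h mod B)  ≡⟨ cong toℕ eq ⟩
  toℕ (h' mod B) ≡⟨ toℕ-fromℕ< _ ⟩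
  h' % B         ≡⟨ m<n⇒m%n≡m h'<B ⟩
  h'             ∎
  where open ≡-Reasoning

encode-injective : ∀ {j} B .{{_ : NonZero B}} {hs hs' : Vec ℕ j} →
  All (_< B) hs → All (_< B) hs' → encode B hs ≡ encode B hs' → hs ≡ hs'
encode-injective B {[]}     {[]}       []         []           _  = refl
encode-injective B {h ∷ hs} {h' ∷ hs'} (h< ∷ hs<) (h'< ∷ hs'<) eq
  with combine-injective (h mod B) (encode B hs) (h' mod B) (encode B hs') eq
... | eqʰ , eqᵗ = cong₂ _∷_ (mod-injective-< h< h'< eqʰ) (encode-injective B hs< hs'< eqᵗ)

countFrom : (ℕ → Bool) → ℕ → ℕ → ℕ
countFrom P a zero      = 0
countFrom P a (suc len) = (if P a then 1 else 0) + countFrom P (suc a) len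

select : ∀ P a len → Fin (countFrom P a len) → ℕ
select P a (suc len) i with P a
select P a (suc len) zero    | true  = a
select P a (suc len) (suc i) | true  = select P (suc a) len i
select P a (suc len) i       | false = select P (suc a) len i

window-suc : ∀ {a len x} {Q : Set} → suc a ≤ x × x < suc a + len × Q → a ≤ x × x < a + suc len × Q
window-suc {a} {len} {x} (a<x , x<end , q) = <⇒≤ a<x , subst (x <_) (sym (+-suc a len)) x<end , q

select-∈ : ∀ P a len i →
  a ≤ select P a len i × select P a len i < a + len × P (select P a len i) ≡ true
select-∈ P a (suc len) i with P a in Pa
select-∈ P a (suc len) zero    | true  = ≤-refl , m<m+n a (s≤s z≤n) , Pa
select-∈ P a (suc len) (suc i) | true  = window-suc (select-∈ P (suc a) len i)
select-∈ P a (suc len) i       | false = window-suc (select-∈ P (suc a) len i)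

select-injective : ∀ P a len {i j} → select P a len i ≡ select P a len j → i ≡ j
select-injective P a (suc len) {i} {j} eq with P a
select-injective P a (suc len) {zero}  {zero}  eq | true = refl
select-injective P a (suc len) {zero}  {suc j} eq | true =
  contradiction eq (<⇒≢ (select-∈ P (suc a) len j .proj₁))
select-injective P a (suc len) {suc i} {zero}  eq | true =
  contradiction (sym eq) (<⇒≢ (select-∈ P (suc a) len i .proj₁))
select-injective P a (suc len) {suc i} {suc j} eq | true =
  cong suc (select-injective P (suc a) len eq)
select-injective P a (suc len) eq | false = select-injective P (suc a) len eq

countFrom-≤ : ∀ P {M} (key : ℕ → Fin M) a len →
  (∀ {t t'} → a ≤ t → t < t' → t' < a + len → P t ≡ true → P t' ≡ true → key t ≢ key t') →
  countFrom P a len ≤ M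
countFrom-≤ P key a len distinct = injective⇒≤ {f = key ∘ select P a len} injective
  where
  injective : ∀ {i j} → key (select P a len i) ≡ key (select P a len j) → i ≡ j
  injective {i} {j} eq
    with <-cmp (select P a len i) (select P a len j) | select-∈ P a len i | select-∈ P a len j
  ... | tri< lt _ _ | a≤i , _ , Pi | _ , j<end , Pj = contradiction eq (distinct a≤i lt j<end Pi Pj)
  ... | tri≈ _ eq' _ | _ | _ = select-injective P a len eq'
  ... | tri> _ _ gt | _ , i<end , Pi | a≤j , _ , Pj = contradiction (sym eq) (distinct a≤j gt i<end Pj Pi)

module _ {s σ d k : ℕ} (A : WORM s σ d k) (w : List (Fin σ)) where
  open WORM A using (fill) renaming (trans to δ)
  open Config

  record Step (c c' : Config s d k) (mm : MMove) : Set where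
    field
      written   : ℕ → Maybe (Fin d)
      writes    : writePhase A w c ≡ just written
      mem≡      : mem c' ≡ written
      mpos≡     : mpos c' ≡ moveMem mm (mpos c)
      headMoves : Vec HMove k
      moves     : moveHeads (length w) headMoves (heads c) ≡ just (heads c')

  transition⇒Step : ∀ {c c' mm} → transition A w c ≡ just (c' , mm) → Step c c' mm
  transition⇒Step {config q hs p m} eq with writePhase A w (config q hs p m) in ew
  ... | just m' with m' p
  ...   | just x with δ q (readHeads w hs) (just x)
  ...     | q' , ms , mm' with moveHeads (length w) ms hs in eh
  transition⇒Step {config q hs p m} refl | just m' | just x | q' , ms , mm' | just hs' =
    record { written = m' ; writes = ew ; mem≡ = refl ; mpos≡ = refl ; headMoves = ms ; moves = eh }

  writePhase-≢ : ∀ {c m'} → writePhase A w c ≡ just m' → ∀ {x} → mpos c ≢ x → m' x ≡ mem c x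
  writePhase-≢ {config q hs p m} eq p≢x with fill q
  writePhase-≢ {config q hs p m} refl p≢x | nothing = refl
  ... | just y with m p
  writePhase-≢ {config q hs p m} refl p≢x | just y | nothing = writeCell-≢ m y p≢x
  ... | just z with z ≟ᶠ y
  writePhase-≢ {config q hs p m} refl p≢x | just y | just z | yes _ = refl
  writePhase-≢ {config q hs p m} () p≢x | just y | just z | no _

  record Shifted (sh : ℕ) (c c' : Config s d k) : Set where
    field
      state≡ : state c' ≡ state c
      heads≡ : heads c' ≡ heads c
      mpos≡  : mpos c' ≡ sh + mpos c
      mem≡   : ∀ x → mpos c ≤ x → mem c' (sh + x) ≡ mem c x

  data WriteShift (sh p : ℕ) : (m m' : Maybe (ℕ → Maybe (Fin d))) → Set where
    both-fail  : WriteShift sh p nothing nothing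
    both-write : ∀ {m m'} → (∀ x → p ≤ x → m' (sh + x) ≡ m x) → WriteShift sh p (just m) (just m')

  writePhase-shift : ∀ sh q hs p m m' → (∀ x → p ≤ x → m' (sh + x) ≡ m x) →
    WriteShift sh p (writePhase A w (config q hs p m)) (writePhase A w (config q hs (sh + p) m'))
  writePhase-shift sh q hs p m m' agree with fill q
  ... | nothing = both-write agree
  ... | just y with m p | m' (sh + p) | agree p ≤-refl
  ...   | nothing | .nothing  | refl = both-write (λ x p≤x → writeCell-+ {m = m} {m'} sh y (agree x p≤x))
  ...   | just z  | .(just z) | refl with z ≟ᶠ y
  ...     | yes _ = both-write agree
  ...     | no  _ = both-fail

  transition-shift : ∀ {sh c c' e' mm} → Shifted sh c c' → transition A w c' ≡ just (e' , mm) →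
    Σ[ e ∈ Config s d k ] (transition A w c ≡ just (e , mm) × (mm ≢ minus → Shifted sh e e'))
  transition-shift {sh} {config q hs p m} {config .q .hs .(sh + p) m'}
    record { state≡ = refl ; heads≡ = refl ; mpos≡ = refl ; mem≡ = agree } eq
    with writePhase A w (config q hs p m) | writePhase A w (config q hs (sh + p) m')
       | writePhase-shift sh q hs p m m' agree
  ... | nothing | nothing | both-fail with eq
  ...   | ()
  transition-shift {sh} {config q hs p m} {config .q .hs .(sh + p) m'} _ eq
    | just m₁ | just m₁' | both-write agree₁ with m₁ p | m₁' (sh + p) | agree₁ p ≤-refl
  ... | nothing | .nothing | refl with eq
  ...   | ()
  transition-shift {sh} {config q hs p m} {config .q .hs .(sh + p) m'} _ eq
    | just m₁ | just m₁' | both-write agree₁ | just x | .(just x) | refl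
    with δ q (readHeads w hs) (just x)
  ... | q' , ms , mm' with moveHeads (length w) ms hs
  ...   | nothing with eq
  ...     | ()
  transition-shift {sh} {config q hs p m} {config .q .hs .(sh + p) m'} _ refl
    | just m₁ | just m₁' | both-write agree₁ | just x | .(just x) | refl
    | q' , ms , mm' | just hs' =
    config q' hs' (moveMem mm' p) m₁ , refl , λ ≢minus → record
      { state≡ = refl ; heads≡ = refl ; mpos≡ = moveMem-+ mm' sh p ≢minus
      ; mem≡ = λ x le → agree₁ x (≤-trans (≤-moveMem mm' p ≢minus) le) }

  run-suc⁻ : ∀ t {c'} → run A w (suc t) ≡ just c' →
    Σ[ c ∈ Config s d k ] Σ[ mm ∈ MMove ] (run A w t ≡ just c × transition A w c ≡ just (c' , mm))
  run-suc⁻ t eq with run A w t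
  ... | just c with transition A w c in tr
  run-suc⁻ t refl | just c | just (c' , mm) = c , mm , refl , tr

  run-suc⁺ : ∀ t {c c' mm} → run A w t ≡ just c → transition A w c ≡ just (c' , mm) →
    run A w (suc t) ≡ just c'
  run-suc⁺ t rc tr rewrite rc | tr = refl

  run-≤′ : ∀ {t u c} → t ≤′ u → run A w u ≡ just c → Σ[ c' ∈ Config s d k ] run A w t ≡ just c'
  run-≤′ ≤′-refl        ru = _ , ru
  run-≤′ {u = suc u} (≤′-step t≤u) ru with _ , _ , ru' , _ ← run-suc⁻ u ru = run-≤′ t≤u ru'

  run-≤-return : ∀ {t r} → t ≤ r → ReturnAt A w r → Σ[ c ∈ Config s d k ] run A w t ≡ just c
  run-≤-return t≤r (_ , _ , rr , _) = run-≤′ (≤⇒≤′ t≤r) rr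

  run-heads-< : ∀ t {c} → run A w t ≡ just c → All (_< 2 + length w) (heads c)
  run-heads-< zero    refl = replicate-< k
    where
    replicate-< : ∀ j → All (_< 2 + length w) (replicate j 0)
    replicate-< zero    = []
    replicate-< (suc j) = s≤s z≤n ∷ replicate-< j
  run-heads-< (suc t) rc with c₀ , _ , rc₀ , tr ← run-suc⁻ t rc =
    moveHeads-< (length w) headMoves (run-heads-< t rc₀) moves
    where open Step (transition⇒Step tr)

  cellAt-just : ∀ t {c} → run A w t ≡ just c → cellAt A w t ≡ mpos c
  cellAt-just t eq with run A w t
  cellAt-just t refl | just c = refl

  cellAt-suc : ∀ t → cellAt A w (suc t) ≡ 0
                   ⊎ cellAt A w (suc t) ≡ cellAt A w t
                   ⊎ cellAt A w (suc t) ≡ suc (cellAt A w t)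
  cellAt-suc t with run A w (suc t) in rc
  ... | nothing = inj₁ refl
  ... | just c with c₀ , mm , rc₀ , tr ← run-suc⁻ t rc =
    subst (λ n → mpos c ≡ 0 ⊎ mpos c ≡ n ⊎ mpos c ≡ suc n) (sym (cellAt-just t rc₀))
      (subst (λ n → n ≡ 0 ⊎ n ≡ mpos c₀ ⊎ n ≡ suc (mpos c₀))
             (sym (Step.mpos≡ (transition⇒Step tr)))
        (moveMem-cases mm (mpos c₀)))

  visited-below : ∀ t {q} → q ≤ cellAt A w t → Σ[ u ∈ ℕ ] (u ≤ t × cellAt A w u ≡ q)
  visited-below zero    q≤ = 0 , z≤n , sym (n≤0⇒n≡0 q≤)
  visited-below (suc t) {q} q≤ with cellAt-suc t
  ... | inj₁ reset = 0 , z≤n , sym (n≤0⇒n≡0 (subst (q ≤_) reset q≤))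
  ... | inj₂ (inj₁ same) = map₂ (map₁ m≤n⇒m≤1+n) (visited-below t (subst (q ≤_) same q≤))
  ... | inj₂ (inj₂ up) with m≤n⇒m<n∨m≡n (subst (q ≤_) up q≤)
  ...   | inj₁ q<   = map₂ (map₁ m≤n⇒m≤1+n) (visited-below t (s≤s⁻¹ q<))
  ...   | inj₂ refl = suc t , ≤-refl , up

  written⇒visited : ∀ t {c x v} → run A w t ≡ just c → mem c x ≡ just v →
    Σ[ u ∈ ℕ ] (u < t × cellAt A w u ≡ x)
  written⇒visited zero refl ()
  written⇒visited (suc t) {c} {x} {v} rc cx with c₀ , _ , rc₀ , tr ← run-suc⁻ t rc with mpos c₀ ≟ x
  ... | yes refl = t , ≤-refl , cellAt-just t rc₀
  ... | no p≢x = map₂ (map₁ m<n⇒m<1+n) (written⇒visited t rc₀ (begin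
    mem c₀ x  ≡⟨ writePhase-≢ {c₀} writes p≢x ⟨
    written x ≡⟨ cong (λ m → m x) mem≡ ⟨
    mem c x   ≡⟨ cx ⟩
    just v    ∎))
    where open Step (transition⇒Step tr)
          open ≡-Reasoning

  isNew⇒fresh : ∀ {t u} → isNew A w t ≡ true → u < t → cellAt A w u ≢ cellAt A w t
  isNew⇒fresh new u<t same = subst T (Equivalence.to T-not-≡ (Equivalence.from T-≡ new))
    (any⁺ _ (lose (∈-upTo⁺ u<t) (≡⇒≡ᵇ _ _ same)))

  isNew⇒void-above : ∀ t {c x} → run A w t ≡ just c → isNew A w t ≡ true → mpos c ≤ x →
    mem c x ≡ nothing
  isNew⇒void-above t {c} {x} rc new p≤x with mem c x in cx
  ... | nothing = refl
  ... | just v with u , u<t , ux ← written⇒visited t rc cx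
               with u' , u'≤u , u'p ← visited-below u (subst (mpos c ≤_) (sym ux) p≤x) =
    contradiction (trans u'p (sym (cellAt-just t rc))) (isNew⇒fresh new (≤-<-trans u'≤u u<t))

  NoReturnIn : ℕ → ℕ → Set
  NoReturnIn a b = ∀ u → a ≤ u → u < b → ¬ ReturnAt A w u

  ¬ReturnAt⇒≢minus : ∀ {t c c' mm} → ¬ ReturnAt A w t → run A w t ≡ just c →
    transition A w c ≡ just (c' , mm) → mm ≢ minus
  ¬ReturnAt⇒≢minus noReturn rc tr refl = noReturn (_ , _ , rc , tr)

  cellAt-suc-≥ : ∀ t {c} → ¬ ReturnAt A w t → run A w (suc t) ≡ just c →
    cellAt A w t ≤ cellAt A w (suc t)
  cellAt-suc-≥ t {c} noReturn rc with c₀ , mm , rc₀ , tr ← run-suc⁻ t rc = begin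
    cellAt A w t          ≡⟨ cellAt-just t rc₀ ⟩
    mpos c₀               ≤⟨ ≤-moveMem mm _ (¬ReturnAt⇒≢minus {t} noReturn rc₀ tr) ⟩
    moveMem mm (mpos c₀)  ≡⟨ Step.mpos≡ (transition⇒Step tr) ⟨
    mpos c                ≡⟨ cellAt-just (suc t) rc ⟨
    cellAt A w (suc t)    ∎
    where open ≤-Reasoning

  cellAt-mono : ∀ {a b c} → a ≤′ b → run A w b ≡ just c → NoReturnIn a b →
    cellAt A w a ≤ cellAt A w b
  cellAt-mono ≤′-refl _ _ = ≤-refl
  cellAt-mono {b = suc b} (≤′-step a≤b) rc noReturn with _ , _ , rc₀ , _ ← run-suc⁻ b rc =
    ≤-trans (cellAt-mono a≤b rc₀ (λ u a≤u u<b → noReturn u a≤u (m<n⇒m<1+n u<b)))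
            (cellAt-suc-≥ b (noReturn b (≤′⇒≤ a≤b) ≤-refl) rc)

  isNew⇒Shifted : ∀ t t' {c c'} → run A w t ≡ just c → run A w t' ≡ just c' →
    isNew A w t ≡ true → isNew A w t' ≡ true → mpos c ≤ mpos c' →
    state c' ≡ state c → heads c' ≡ heads c → Shifted (mpos c' ∸ mpos c) c c'
  isNew⇒Shifted t t' {c} {c'} rc rc' new new' p≤p' state≡ heads≡ = record
    { state≡ = state≡ ; heads≡ = heads≡ ; mpos≡ = sym (m∸n+n≡m p≤p')
    ; mem≡   = λ x p≤x → trans (isNew⇒void-above t' rc' new' (p'≤ p≤x))
                               (sym (isNew⇒void-above t rc new p≤x)) }
    where
    sh = mpos c' ∸ mpos c
    p'≤ : ∀ {x} → mpos c ≤ x → mpos c' ≤ sh + x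
    p'≤ {x} p≤x = subst (_≤ sh + x) (m∸n+n≡m p≤p') (+-monoʳ-≤ sh p≤x)

  return-shift : ∀ j {sh t t' c c'} → run A w t ≡ just c → run A w t' ≡ just c' → Shifted sh c c' →
    NoReturnIn t' (t' + j) → ReturnAt A w (t' + j) → ReturnAt A w (t + j)
  return-shift zero {t = t} {t'} {c} rc rc' shifted _ ret
    with _ , _ , rc'' , tr ← subst (ReturnAt A w) (+-identityʳ t') ret
    with refl ← trans (sym rc') rc''
    with e , tr₀ , _ ← transition-shift shifted tr =
    subst (ReturnAt A w) (sym (+-identityʳ t)) (c , e , rc , tr₀)
  return-shift (suc j) {t = t} {t'} rc rc' shifted noReturn ret
    with f' , rf' ← run-≤-return (m<m+n t' (s≤s z≤n)) ret
    with _ , mm , rc'' , tr ← run-suc⁻ t' rf'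
    with refl ← trans (sym rc') rc''
    with f , tr₀ , shifted-next ← transition-shift shifted tr =
    subst (ReturnAt A w) (sym (+-suc t j))
      (return-shift j {t = suc t} {suc t'} (run-suc⁺ t rc tr₀) rf' (shifted-next ≢minus) noReturn′
        (subst (ReturnAt A w) (+-suc t' j) ret))
    where
    ≢minus : mm ≢ minus
    ≢minus = ¬ReturnAt⇒≢minus {t'} (noReturn t' ≤-refl (m<m+n t' (s≤s z≤n))) rc' tr
    noReturn′ : NoReturnIn (suc t') (suc t' + j)
    noReturn′ u t'<u u<end = noReturn u (<⇒≤ t'<u) (subst (u <_) (sym (+-suc t' j)) u<end)

  repeat⇒return-inside : ∀ {r₁ r₂} t t' {c c'} → r₁ < t → t < t' → t' ≤ r₂ →
    ReturnAt A w r₂ → run A w t ≡ just c → run A w t' ≡ just c' →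
    isNew A w t ≡ true → isNew A w t' ≡ true → state c' ≡ state c → heads c' ≡ heads c →
    ¬ NoReturnIn (suc r₁) r₂
  repeat⇒return-inside {r₁} {r₂} t t' {c} {c'} r₁<t t<t' t'≤r₂ ret rc rc' new new' state≡ heads≡
    noReturn =
    noReturn (t + j) (after (m≤m+n t j)) (subst (t + j <_) t'+j≡r₂ (+-monoˡ-< j t<t'))
      (return-shift j {t = t} {t'} rc rc' shifted
        (λ u t'≤u u<end → noReturn u (after (≤-trans (<⇒≤ t<t') t'≤u)) (subst (u <_) t'+j≡r₂ u<end))
        (subst (ReturnAt A w) (sym t'+j≡r₂) ret))
    where
    after : ∀ {u} → t ≤ u → suc r₁ ≤ u
    after = ≤-trans r₁<t
    j : ℕ
    j = r₂ ∸ t'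
    t'+j≡r₂ : t' + j ≡ r₂
    t'+j≡r₂ = m+[n∸m]≡n t'≤r₂
    p≤p' : mpos c ≤ mpos c'
    p≤p' = subst₂ _≤_ (cellAt-just t rc) (cellAt-just t' rc')
      (cellAt-mono (≤⇒≤′ (<⇒≤ t<t')) rc' (λ u t≤u u<t' → noReturn u (after t≤u) (<-≤-trans u<t' t'≤r₂)))
    shifted : Shifted (mpos c' ∸ mpos c) c c'
    shifted = isNew⇒Shifted t t' rc rc' new new' p≤p' state≡ heads≡

  configKey : Config s d k → Fin ((2 + length w) ^ k * s)
  configKey c = combine (encode (2 + length w) (heads c)) (state c)

  configKey-injective : ∀ {c c'} → All (_< 2 + length w) (heads c) → All (_< 2 + length w) (heads c') →
    configKey c ≡ configKey c' → state c ≡ state c' × heads c ≡ heads c'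
  configKey-injective {c} {c'} hs< hs'< eq
    with heads≡ , state≡ ← combine-injective (encode _ (heads c)) (state c)
                                             (encode _ (heads c')) (state c') eq =
    state≡ , encode-injective (2 + length w) hs< hs'< heads≡

  -- The default for an undefined run is never consulted: keys are compared only at times
  -- before a return move, where the run is defined.
  keyAt : ℕ → Fin ((2 + length w) ^ k * s)
  keyAt t = configKey (fromMaybe (initConfig A w) (run A w t))

  keyAt-just : ∀ t {c} → run A w t ≡ just c → keyAt t ≡ configKey c
  keyAt-just t = cong (configKey ∘ fromMaybe (initConfig A w))

  newCellsFrom≡countFrom : ∀ a len → newCellsFrom A w a len ≡ countFrom (isNew A w) a len
  newCellsFrom≡countFrom a zero      = refl
  newCellsFrom≡countFrom a (suc len) = cong (_ +_) (newCellsFrom≡countFrom (suc a) len)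

  newCellsFrom-≤ : ∀ {r₁ r₂} → r₁ < r₂ → ReturnAt A w r₂ → NoReturnIn (suc r₁) r₂ →
    newCellsFrom A w (suc r₁) (r₂ ∸ r₁) ≤ (2 + length w) ^ k * s
  newCellsFrom-≤ {r₁} {r₂} r₁<r₂ ret noReturn =
    subst (_≤ _) (sym (newCellsFrom≡countFrom (suc r₁) (r₂ ∸ r₁)))
      (countFrom-≤ (isNew A w) keyAt (suc r₁) (r₂ ∸ r₁) distinct)
    where
    <-end⇒≤ : ∀ {t} → t < suc r₁ + (r₂ ∸ r₁) → t ≤ r₂
    <-end⇒≤ {t} t<end = s≤s⁻¹ (subst (t <_) (cong suc (m+[n∸m]≡n (<⇒≤ r₁<r₂))) t<end)

    distinct : ∀ {t t'} → suc r₁ ≤ t → t < t' → t' < suc r₁ + (r₂ ∸ r₁) →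
      isNew A w t ≡ true → isNew A w t' ≡ true → keyAt t ≢ keyAt t'
    distinct {t} {t'} r₁<t t<t' t'<end new new' same
      with t'≤r₂ ← <-end⇒≤ t'<end
      with c , rc ← run-≤-return (≤-trans (<⇒≤ t<t') t'≤r₂) ret
      with c' , rc' ← run-≤-return t'≤r₂ ret
      with state≡ , heads≡ ← configKey-injective {c} {c'} (run-heads-< t rc) (run-heads-< t' rc')
                               (trans (sym (keyAt-just t rc)) (trans same (keyAt-just t' rc'))) =
      repeat⇒return-inside t t' r₁<t t<t' t'≤r₂ ret rc rc' new new' (sym state≡) (sym heads≡) noReturn

proposition1 : ∀ {s σ d k : ℕ} (A : WORM s σ d k) (w : List (Fin σ)) (T : ℕ) →
    AcceptsAt A w T →
    ∀ (r₁ r₂ : ℕ) → r₁ < r₂ → r₂ < T → ReturnAt A w r₁ → ReturnAt A w r₂ →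
    (∀ t → r₁ < t → t < r₂ → ¬ ReturnAt A w t) →
    newCellsFrom A w (suc r₁) (r₂ ∸ r₁) ≤ (length w + 2) ^ k * s
proposition1 {s} {k = k} A w _ _ r₁ r₂ r₁<r₂ _ _ ret noReturn =
  subst (λ B → newCellsFrom A w (suc r₁) (r₂ ∸ r₁) ≤ B ^ k * s) (+-comm 2 (length w))
    (newCellsFrom-≤ A w r₁<r₂ ret noReturn)
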